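{- There is no linear order $<$ on the vertex set of $\mathbf S(2)$ such that $\mathrm{Age}(\mathbf S(2),<)$ has both the Ramsey property and the expansion property relative to $\mathrm{Age}(\mathbf S(2))$.
   Context: Let $\mathbb T$ be the unit circle in $\mathbb C$ and for $x,y\in\mathbb T$ put an arc from $x$ to $y$ iff $0<\arg(y/x)<\pi$ (arguments in $[0,2\pi)$). The dense local order $\mathbf S(2)$ is the directed graph induced on the set $S$ of points of $\mathbb T$ whose argument (in radians) is rational; it is a structure in the language with one binary relation symbol. $(\mathbf S(2),<)$ is the expansion by a linear order in the language with an extra binary symbol $<$. Ages are classes of finite structures embeddable in the given structure. Ramsey property of a class $\mathcal K$: for all $k$ and $\mathbf A,\mathbf B\in\mathcal K$ there is $\mathbf C\in\mathcal K$ such that for every $k$-colouring of the substructures of $\mathbf C$ isomorphic to $\mathbf A$ there is a substructure $\mathbf B'\cong\mathbf B$ of $\mathbf C$ in which all substructures isomorphic to $\mathbf A$ get the same colour. Expansion property of $\mathrm{Age}(\mathbf S(2),<)$ relative to $\mathrm{Age}(\mathbf S(2))$: for every $\mathbf A\in\mathrm{Age}(\mathbf S(2))$ there is $\mathbf B\in\mathrm{Age}(\mathbf S(2))$ such that every $\mathbf A^{*}\in\mathrm{Age}(\mathbf S(2),<)$ with reduct $\mathbf A$ embeds into every $\mathbf B^{*}\in\mathrm{Age}(\mathbf S(2),<)$ with reduct $\mathbf B$. -}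

module Defs where

open import Data.Nat as ℕ using (ℕ; zero; suc)
open import Data.Integer using (+_)
open import Data.Rational using (ℚ; _/_; _+_; _-_; _*_; -_; _<_; _≤_; 0ℚ; ½)
open import Data.Bool using (Bool; T)
open import Data.Fin using (Fin; zero; suc)
open import Data.Fin.Subset using (Subset; _∈_; _⊆_)
open import Data.Product using (Σ; ∃; ∃-syntax; _×_; _,_)
open import Data.Sum using (_⊎_)
open import Data.Unit using (⊤)
open import Function.Bundles using (_⇔_)
open import Relation.Nullary using (¬_)
open import Relation.Binary.PropositionalEquality using (_≡_; _≢_)

-- π as a Dedekind cut in ℚ, via the Leibniz series
-- π = Σ_{k ≥ 0} (-1)^k · 4/(2k+1).
-- leibniz m = Σ_{k < m} (-1)^k · 4/(2k+1)  (partial sums).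
-- The even partial sums leibniz (2n+2) increase strictly to π,
-- the odd partial sums leibniz (2n+1) decrease strictly to π.

term : ℕ → ℚ
term k = + 4 / suc (2 ℕ.* k)

leibniz : ℕ → ℚ
leibniz zero = 0ℚ
leibniz (suc m) with m ℕ.% 2
... | zero = leibniz m + term m
... | suc _ = leibniz m - term m

lowerπ upperπ : ℕ → ℚ
lowerπ n = leibniz (2 ℕ.+ 2 ℕ.* n)
upperπ n = leibniz (1 ℕ.+ 2 ℕ.* n)

_<π : ℚ → Set
q <π = ∃[ n ] (q < lowerπ n)

π<_ : ℚ → Set
π< q = ∃[ n ] (upperπ n < q)

-- The dense local order S(2).
-- A point of 𝕋 is identified with its argument θ ∈ [0, 2π).
-- S = points whose argument θ is rational: θ ∈ ℚ, 0 ≤ θ < 2π.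

InS : ℚ → Set
InS θ = (0ℚ ≤ θ) × ((θ * ½) <π)

-- arg(y/x) = y - x if y ≥ x, and y - x + 2π otherwise.
-- 0 < arg(y/x) < π  iff  (0 < y - x < π)  or  (y - x < -π).
Arc : ℚ → ℚ → Set
Arc x y = ((0ℚ < (y - x)) × ((y - x) <π)) ⊎ (π< (- (y - x)))

record Str (r : ℕ) : Set₁ where
  field
    Carrier : Set
    Dom     : Carrier → Set
    rel     : Fin r → Carrier → Carrier → Set

record FinStr (r n : ℕ) : Set where
  field
    frel : Fin r → Fin n → Fin n → Bool
open FinStr public

toStr : ∀ {r n} → FinStr r n → Str r
toStr {r} {n} A = record { Carrier = Fin n ; Dom = λ _ → ⊤ ; rel = λ ρ a b → T (frel A ρ a b) }

record Emb {r n : ℕ} (A : FinStr r n) (M : Str r) : Set where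
  field
    map   : Fin n → Str.Carrier M
    inDom : ∀ i → Str.Dom M (map i)
    inj   : ∀ i j → map i ≡ map j → i ≡ j
    pres  : ∀ ρ a b → T (frel A ρ a b) ⇔ Str.rel M ρ (map a) (map b)
open Emb public

Age : ∀ {r} → Str r → ∀ {n} → FinStr r n → Set
Age M A = Emb A M

Class : ℕ → Set₁
Class r = ∀ {n} → FinStr r n → Set

IsImage : ∀ {r n m} {A : FinStr r n} {C : FinStr r m} → Emb A (toStr C) → Subset m → Set
IsImage f S = ∀ j → (j ∈ S) ⇔ (∃[ i ] (map f i ≡ j))

IsCopy : ∀ {r n m} → FinStr r n → (C : FinStr r m) → Subset m → Set
IsCopy A C S = ∃[ f ] IsImage {A = A} {C = C} f S

Ramsey : ∀ {r} → Class r → Set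
Ramsey {r} K =
  ∀ (k : ℕ) {a b} (A : FinStr r a) (B : FinStr r b) → K A → K B →
  ∃[ m ] Σ (FinStr r m) λ C → K C ×
    (∀ (χ : Subset m → Fin k) →
      ∃[ g ] Σ (Subset m) λ B' → IsImage {A = B} {C = C} g B' ×
        ∃[ c ] (∀ S → IsCopy A C S → S ⊆ B' → χ S ≡ c))

-- Reduct: forget the second relation (index 1) of a structure with two relations.
-- A* (with relations 0 = arc, 1 = order) has reduct A (with relation 0 = arc).
HasReduct : ∀ {n} → FinStr 2 n → FinStr 1 n → Set
HasReduct A* A = ∀ a b → frel A* zero a b ≡ frel A zero a b

Expansion : Class 2 → Class 1 → Set
Expansion K* K =
  ∀ {a} (A : FinStr 1 a) → K A →
  ∃[ b ] Σ (FinStr 1 b) λ B → K B ×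
    (∀ (A* : FinStr 2 a) → K* A* → HasReduct A* A →
     ∀ (B* : FinStr 2 b) → K* B* → HasReduct B* B →
     Emb A* (toStr B*))

S2 : Str 1
S2 = record { Carrier = ℚ ; Dom = InS ; rel = λ _ → Arc }

S2< : (ℚ → ℚ → Set) → Str 2
S2< _≺_ = record { Carrier = ℚ ; Dom = InS ; rel = λ { zero → Arc ; (suc _) → _≺_ } }

IsLinearOrderOnS : (ℚ → ℚ → Set) → Set
IsLinearOrderOnS _≺_ =
  (∀ x → InS x → ¬ (x ≺ x)) ×
  (∀ x y z → InS x → InS y → InS z → x ≺ y → y ≺ z → x ≺ z) ×
  (∀ x y → InS x → InS y → x ≢ y → (x ≺ y) ⊎ (y ≺ x))

-- Ramsey property alone already fails, for colourings of vertices.  Colour each point of 𝕋 by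
-- which of four consecutive arcs of length 2 < π (argument in [0,2), [2,4), [4,6), [6,8))
-- contains it.  An arc of S(2) between two points of the same band can only go forward in
-- argument, since a wrap-around arc would need a gap bigger than π.  Hence the directed
-- 3-cycle 0 → 2 → 4 → 0, with whatever order ≺ induces on it, has no monochromatic copy in
-- any finite substructure of (S(2), ≺), while Ramsey applied to the one-point structure
-- would provide one.
module Submission where

open import Defs
open import Data.Bool using (Bool; true; false; T)
open import Data.Fin using (Fin; zero; suc)
open import Data.Fin.Properties using (suc-injective)
open import Data.Fin.Subset using (Subset; ⁅_⁆; _∈_)
open import Data.Fin.Subset.Properties using (x∈⁅x⁆; x∈⁅y⁆⇒x≡y)
open import Data.Integer using (+_; +≤+)
open import Data.Integer.Properties as ℤ using ()
open import Data.Nat as ℕ using (ℕ; zero; suc)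
open import Data.Nat.Divisibility using (m∣m*n)
open import Data.Nat.DivMod using (%-remove-+ʳ)
open import Data.Nat.Properties as ℕ using ()
open import Data.Product using (Σ; ∃-syntax; _×_; _,_; proj₁; proj₂)
open import Data.Rational
open import Data.Rational.Properties
open import Data.Rational.Solver using (module +-*-Solver)
import Data.Rational.Unnormalised as ℚᵘ
import Data.Rational.Unnormalised.Properties as ℚᵘ
open import Data.Sum using (_⊎_; inj₁; inj₂)
open import Data.Unit using (tt)
open import Data.Vec using (_∷_; [])
open import Function using (_∘_)
open import Function.Bundles using (_⇔_; mk⇔; Equivalence)
open import Function.Properties.Equivalence using () renaming (trans to ⇔-trans)
open import Relation.Binary.PropositionalEquality
open import Relation.Nullary using (¬_; Dec; yes; no; contradiction)
open import Relation.Nullary.Decidable using (True; isYes; toWitness; fromWitness)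

open +-*-Solver

≤-decide : ∀ p q {_ : True (p ≤? q)} → p ≤ q
≤-decide p q {t} = toWitness t

<-decide : ∀ p q {_ : True (p <? q)} → p < q
<-decide p q {t} = toWitness t

two four six eight : ℚ
two = + 2 / 1
four = + 4 / 1
six = + 6 / 1
eight = + 8 / 1

open ≤-Reasoning

p≤[p+q]-r : ∀ p q r → r ≤ q → p ≤ (p + q) - r
p≤[p+q]-r p q r r≤q = begin
  p            ≡⟨ solve 2 (λ p q → p := (p :+ q) :- q) refl p q ⟩
  (p + q) - q  ≤⟨ +-monoʳ-≤ (p + q) (neg-antimono-≤ r≤q) ⟩
  (p + q) - r  ∎

[p-q]+r≤p : ∀ p q r → r ≤ q → (p - q) + r ≤ p
[p-q]+r≤p p q r r≤q = begin
  (p - q) + r  ≤⟨ +-monoʳ-≤ (p - q) r≤q ⟩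
  (p - q) + q  ≡⟨ solve 2 (λ p q → (p :- q) :+ q := p) refl p q ⟩
  p            ∎

0<q-p⇒p<q : ∀ p q → 0ℚ < q - p → p < q
0<q-p⇒p<q p q 0<q-p = subst₂ _<_ (+-identityˡ p) (solve 2 (λ p q → (q :- p) :+ p := q) refl p q)
  (+-monoˡ-< p 0<q-p)

p<q+r⇒-[q-p]<r : ∀ p q r → p < q + r → - (q - p) < r
p<q+r⇒-[q-p]<r p q r p<q+r = subst₂ _<_ (solve 2 (λ p q → p :- q := :- (q :- p)) refl p q)
  (solve 2 (λ q r → (q :+ r) :- q := r) refl q r) (+-monoˡ-< (- q) p<q+r)

p-q≤p : ∀ p q → 0ℚ ≤ q → p - q ≤ p
p-q≤p p q 0≤q = begin
  p - q         ≡⟨ +-identityʳ (p - q) ⟨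
  (p - q) + 0ℚ  ≤⟨ [p-q]+r≤p p q 0ℚ 0≤q ⟩
  p             ∎

fromℚᵘ-mono-≤ : ∀ {p q} → p ℚᵘ.≤ q → fromℚᵘ p ≤ fromℚᵘ q
fromℚᵘ-mono-≤ {p} {q} p≤q = toℚᵘ-cancel-≤
  (ℚᵘ.≤-respˡ-≃ (ℚᵘ.≃-sym (toℚᵘ-fromℚᵘ p)) (ℚᵘ.≤-respʳ-≃ (ℚᵘ.≃-sym (toℚᵘ-fromℚᵘ q)) p≤q))

term-antitone : ∀ k → term (suc k) ≤ term k
term-antitone k = fromℚᵘ-mono-≤ {ℚᵘ.mkℚᵘ (+ 4) (2 ℕ.* suc k)} {ℚᵘ.mkℚᵘ (+ 4) (2 ℕ.* k)}
  (ℚᵘ.*≤* (ℤ.*-monoˡ-≤-nonNeg (+ 4) (+≤+ (ℕ.s≤s (ℕ.*-monoʳ-≤ 2 (ℕ.n≤1+n k))))))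

term-nonNeg : ∀ k → 0ℚ ≤ term k
term-nonNeg k = nonNegative⁻¹ (term k) {{normalize-nonNeg 4 (suc (2 ℕ.* k))}}

leibniz-even : ∀ k → leibniz (suc (2 ℕ.* k)) ≡ leibniz (2 ℕ.* k) + term (2 ℕ.* k)
leibniz-even k with (2 ℕ.* k) ℕ.% 2 | %-remove-+ʳ 0 (m∣m*n {2} k)
... | zero  | _  = refl
... | suc _ | ()

leibniz-odd : ∀ k → leibniz (2 ℕ.+ 2 ℕ.* k) ≡ leibniz (1 ℕ.+ 2 ℕ.* k) - term (1 ℕ.+ 2 ℕ.* k)
leibniz-odd k with (1 ℕ.+ 2 ℕ.* k) ℕ.% 2 | %-remove-+ʳ 1 (m∣m*n {2} k)
... | suc zero    | _  = refl
... | zero        | ()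
... | suc (suc _) | ()

lowerπ≡upperπ-term : ∀ n → lowerπ n ≡ upperπ n - term (1 ℕ.+ 2 ℕ.* n)
lowerπ≡upperπ-term = leibniz-odd

upperπ-suc : ∀ n → upperπ (suc n) ≡ lowerπ n + term (2 ℕ.+ 2 ℕ.* n)
upperπ-suc n = trans (leibniz-even (suc n)) (cong (λ m → leibniz m + term m) (ℕ.*-suc 2 n))

lowerπ-suc : ∀ n → lowerπ (suc n) ≡ (lowerπ n + term (2 ℕ.+ 2 ℕ.* n)) - term (3 ℕ.+ 2 ℕ.* n)
lowerπ-suc n = trans (lowerπ≡upperπ-term (suc n))
  (cong₂ _-_ (upperπ-suc n) (cong (term ∘ suc) (ℕ.*-suc 2 n)))

lowerπ≤upperπ : ∀ n → lowerπ n ≤ upperπ n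
lowerπ≤upperπ n = subst (_≤ upperπ n) (sym (lowerπ≡upperπ-term n))
  (p-q≤p (upperπ n) (term (1 ℕ.+ 2 ℕ.* n)) (term-nonNeg (1 ℕ.+ 2 ℕ.* n)))

lowerπ-increasing : ∀ n → lowerπ 0 ≤ lowerπ n
lowerπ-increasing zero    = ≤-refl
lowerπ-increasing (suc n) = begin
  lowerπ 0              ≤⟨ lowerπ-increasing n ⟩
  lowerπ n              ≤⟨ p≤[p+q]-r (lowerπ n) t₂ t₃ (term-antitone (2 ℕ.+ 2 ℕ.* n)) ⟩
  (lowerπ n + t₂) - t₃  ≡⟨ lowerπ-suc n ⟨
  lowerπ (suc n)        ∎
  where t₂ = term (2 ℕ.+ 2 ℕ.* n); t₃ = term (3 ℕ.+ 2 ℕ.* n)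

upperπ-decreasing : ∀ n → upperπ n ≤ upperπ 0
upperπ-decreasing zero    = ≤-refl
upperπ-decreasing (suc n) = begin
  upperπ (suc n)          ≡⟨ upperπ-suc n ⟩
  lowerπ n + t₂           ≡⟨ cong (_+ t₂) (lowerπ≡upperπ-term n) ⟩
  (upperπ n - t₁) + t₂    ≤⟨ [p-q]+r≤p (upperπ n) t₁ t₂ (term-antitone (1 ℕ.+ 2 ℕ.* n)) ⟩
  upperπ n                ≤⟨ upperπ-decreasing n ⟩
  upperπ 0                ∎
  where t₁ = term (1 ℕ.+ 2 ℕ.* n); t₂ = term (2 ℕ.+ 2 ℕ.* n)

π<⇒2< : ∀ {q} → π< q → two < q
π<⇒2< {q} (n , upper<q) = ≤-<-trans (≤-trans (≤-decide two (lowerπ 0))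
  (≤-trans (lowerπ-increasing n) (lowerπ≤upperπ n))) upper<q

<π⇒<4 : ∀ {q} → q <π → q < four
<π⇒<4 {q} (n , q<lower) = <-≤-trans q<lower
  (≤-trans (lowerπ≤upperπ n) (≤-trans (upperπ-decreasing n) (≤-decide (upperπ 0) four)))

Arc-irrefl : ∀ x → ¬ Arc x x
Arc-irrefl x (inj₁ (0<x-x , _)) = <-irrefl (sym (+-inverseʳ x)) 0<x-x
Arc-irrefl x (inj₂ π<-[x-x])   = <-asym (<-decide 0ℚ two)
  (subst (two <_) (cong -_ (+-inverseʳ x)) (π<⇒2< π<-[x-x]))

-- A wrap-around arc from x to y needs x - y > π > 2.
Arc-short⇒< : ∀ {x y} → x < y + two → Arc x y → x < y
Arc-short⇒< {x} {y} _       (inj₁ (0<y-x , _)) = 0<q-p⇒p<q x y 0<y-x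
Arc-short⇒< {x} {y} x<y+two (inj₂ π<-[y-x])   =
  contradiction (π<⇒2< π<-[y-x]) (<-asym (p<q+r⇒-[q-p]<r x y two x<y+two))

InS⇒<8 : ∀ {x} → InS x → x < eight
InS⇒<8 {x} (_ , x½<π) = subst (_< eight) (solve 1 (λ x → x :* con ½ :* con two := x) refl x)
  (*-monoˡ-<-pos two (<π⇒<4 x½<π))

band : ℚ → Fin 4
band x with x <? two
... | yes _ = zero
... | no _ with x <? four
...   | yes _ = suc zero
...   | no _ with x <? six
...     | yes _ = suc (suc zero)
...     | no _  = suc (suc (suc zero))

bandStart : Fin 4 → ℚ
bandStart zero                   = 0ℚ
bandStart (suc zero)             = two
bandStart (suc (suc zero))       = four
bandStart (suc (suc (suc zero))) = six

band-bounds : ∀ {x} → 0ℚ ≤ x → x < eight → bandStart (band x) ≤ x × x < bandStart (band x) + two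
band-bounds {x} 0≤x x<8 with x <? two
... | yes x<2 = 0≤x , x<2
... | no x≮2 with x <? four
...   | yes x<4 = ≮⇒≥ x≮2 , x<4
...   | no x≮4 with x <? six
...     | yes x<6 = ≮⇒≥ x≮4 , x<6
...     | no x≮6  = ≮⇒≥ x≮6 , x<8

same-band⇒<+2 : ∀ {x y} → InS x → InS y → band x ≡ band y → x < y + two
same-band⇒<+2 {x} {y} x∈S y∈S bx≡by = <-≤-trans (proj₂ (bounds x∈S))
  (+-monoˡ-≤ two (subst (λ i → bandStart i ≤ y) (sym bx≡by) (proj₁ (bounds y∈S))))
  where
  bounds : ∀ {z} → InS z → bandStart (band z) ≤ z × z < bandStart (band z) + two
  bounds (0≤z , z½<π) = band-bounds 0≤z (InS⇒<8 (0≤z , z½<π))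

monochromatic-3-cycle-impossible : ∀ {x y z} → InS x → InS y → InS z →
  band x ≡ band y → band y ≡ band z → Arc x y → Arc y z → ¬ Arc z x
monochromatic-3-cycle-impossible x∈S y∈S z∈S bx≡by by≡bz xy yz zx = <-irrefl refl
  (<-trans (Arc-short⇒< (same-band⇒<+2 x∈S y∈S bx≡by) xy)
    (<-trans (Arc-short⇒< (same-band⇒<+2 y∈S z∈S by≡bz) yz)
             (Arc-short⇒< (same-band⇒<+2 z∈S x∈S (sym (trans bx≡by by≡bz))) zx)))

Loopless : ∀ {r} → Str r → Set
Loopless M = ∀ ρ {x} → Str.Dom M x → ¬ Str.rel M ρ x x

point : ∀ {r} → FinStr r 1
point = record { frel = λ _ _ _ → false }

point-emb : ∀ {r} {M : Str r} {x} → Str.Dom M x → (∀ ρ → ¬ Str.rel M ρ x x) → Emb point M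
point-emb {x = x} x∈M noLoop = record
  { map = λ _ → x ; inDom = λ _ → x∈M ; inj = λ { zero zero _ → refl }
  ; pres = λ { ρ zero zero → mk⇔ (λ ()) (noLoop ρ) } }

emb-∘ : ∀ {r a b} {A : FinStr r a} {B : FinStr r b} {M : Str r} →
        Emb B M → Emb A (toStr B) → Emb A M
emb-∘ f g = record
  { map   = map f ∘ map g
  ; inDom = inDom f ∘ map g
  ; inj   = λ i j fgi≡fgj → inj g i j (inj f (map g i) (map g j) fgi≡fgj)
  ; pres  = λ ρ a b → ⇔-trans (pres g ρ a b) (pres f ρ (map g a) (map g b)) }

emb-loopless : ∀ {r n} {A : FinStr r n} {M : Str r} → Emb A M → Loopless M → Loopless (toStr A)
emb-loopless e M-loopless ρ {i} _ loop = M-loopless ρ (inDom e i) (Equivalence.to (pres e ρ i i) loop)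

singleton-isCopy : ∀ {r m} {C : FinStr r m} → Loopless (toStr C) → ∀ j → IsCopy point C ⁅ j ⁆
singleton-isCopy {C = C} C-loopless j = point-emb {M = toStr C} tt (λ ρ → C-loopless ρ tt) , image
  where
  image : ∀ k → (k ∈ ⁅ j ⁆) ⇔ (∃[ i ] j ≡ k)
  image k = mk⇔ (λ k∈⁅j⁆ → zero , sym (x∈⁅y⁆⇒x≡y j k∈⁅j⁆)) (λ { (_ , refl) → x∈⁅x⁆ j })

onFirst : ∀ {A : Set} {m} → A → (Fin m → A) → Subset m → A
onFirst d f []          = d
onFirst d f (true ∷ _)  = f zero
onFirst d f (false ∷ S) = onFirst d (f ∘ suc) S

onFirst-⁅⁆ : ∀ {A : Set} {m} (d : A) (f : Fin m → A) j → onFirst d f ⁅ j ⁆ ≡ f j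
onFirst-⁅⁆ d f zero    = refl
onFirst-⁅⁆ d f (suc j) = onFirst-⁅⁆ d (f ∘ suc) j

VertexRamsey : ∀ {r} → Class r → Set
VertexRamsey {r} K =
  ∀ (k : ℕ) {b} (B : FinStr r b) → K B →
  ∃[ m ] Σ (FinStr r m) λ C → K C ×
    (∀ (χ : Fin m → Fin k) → Σ (Emb B (toStr C)) λ g → ∀ i j → χ (map g i) ≡ χ (map g j))

-- A vertex colouring χ becomes a colouring of subsets by the colour of their first vertex,
-- shifted by one so that colour zero is left for the empty set.
Ramsey⇒VertexRamsey : ∀ {r} {K : Class r} → Ramsey K → K point →
  (∀ {m} {C : FinStr r m} → K C → Loopless (toStr C)) → VertexRamsey K
Ramsey⇒VertexRamsey ramsey point∈K K-loopless k B B∈K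
  with ramsey (suc k) point B point∈K B∈K
... | m , C , C∈K , arrows = m , C , C∈K , vertexArrows
  where
  vertexArrows : ∀ (χ : Fin m → Fin k) → Σ (Emb B (toStr C)) λ g → ∀ i j → χ (map g i) ≡ χ (map g j)
  vertexArrows χ with arrows (onFirst zero (suc ∘ χ))
  ... | g , B′ , image , c , monochromatic = g , λ i j → suc-injective (trans (colour i) (sym (colour j)))
    where
    colour : ∀ i → suc (χ (map g i)) ≡ c
    colour i = trans (sym (onFirst-⁅⁆ zero (suc ∘ χ) (map g i)))
      (monochromatic ⁅ map g i ⁆ (singleton-isCopy (K-loopless C∈K) (map g i))
        (λ {j} j∈⁅gi⁆ → Equivalence.from (image j) (i , sym (x∈⁅y⁆⇒x≡y (map g i) j∈⁅gi⁆))))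

module LinearOrderExpansion (_≺_ : ℚ → ℚ → Set) (linear : IsLinearOrderOnS _≺_) where
  private
    ≺-irrefl = proj₁ linear
    ≺-trans  = proj₁ (proj₂ linear)
    ≺-total  = proj₂ (proj₂ linear)

  ≺-dec : ∀ {x y} → InS x → InS y → Dec (x ≺ y)
  ≺-dec {x} {y} x∈S y∈S with x ≟ y
  ... | yes refl = no (≺-irrefl x x∈S)
  ... | no x≢y with ≺-total x y x∈S y∈S x≢y
  ...   | inj₁ x≺y = yes x≺y
  ...   | inj₂ y≺x = no (λ x≺y → ≺-irrefl x x∈S (≺-trans x y x x∈S y∈S x∈S x≺y y≺x))

  S2<-loopless : Loopless (S2< _≺_)
  S2<-loopless zero       {x} _   = Arc-irrefl x
  S2<-loopless (suc zero) {x} x∈S = ≺-irrefl x x∈S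

  ordered : ∀ {n} {A : FinStr 1 n} → Emb A S2 → FinStr 2 n
  ordered {A = A} e = record { frel = λ
    { zero       → frel A zero
    ; (suc zero) → λ i j → isYes (≺-dec (inDom e i) (inDom e j)) } }

  ordered-emb : ∀ {n} {A : FinStr 1 n} (e : Emb A S2) → Emb (ordered e) (S2< _≺_)
  ordered-emb e = record
    { map = map e ; inDom = inDom e ; inj = inj e
    ; pres = λ { zero → pres e zero ; (suc zero) a b → mk⇔ toWitness fromWitness } }

cycle₃ : FinStr 1 3
cycle₃ = record { frel = λ _ → arc }
  where
  arc : Fin 3 → Fin 3 → Bool
  arc zero             (suc zero)       = true
  arc (suc zero)       (suc (suc zero)) = true
  arc (suc (suc zero)) zero             = true
  arc _                _                = false

¬Arc : ∀ x y → (y - x ≤ 0ℚ) ⊎ (four ≤ y - x) → - (y - x) ≤ two → ¬ Arc x y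
¬Arc x y (inj₁ y-x≤0) _        (inj₁ (0<y-x , _)) = <-irrefl refl (<-≤-trans 0<y-x y-x≤0)
¬Arc x y (inj₂ 4≤y-x) _        (inj₁ (_ , y-x<π)) = <-irrefl refl (<-≤-trans (<π⇒<4 y-x<π) 4≤y-x)
¬Arc x y _            -[y-x]≤2 (inj₂ π<-[y-x])    = <-irrefl refl (<-≤-trans (π<⇒2< π<-[y-x]) -[y-x]≤2)

cycle₃-emb : Emb cycle₃ S2
cycle₃-emb = record { map = position ; inDom = position∈S ; inj = position-injective ; pres = λ _ → arcs }
  where
  position : Fin 3 → ℚ
  position zero             = 0ℚ
  position (suc zero)       = two
  position (suc (suc zero)) = four

  InS-decide : ∀ x {_ : True (0ℚ ≤? x)} {_ : True (x * ½ <? lowerπ 0)} → InS x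
  InS-decide x {p} {q} = toWitness p , 0 , toWitness q

  position∈S : ∀ i → InS (position i)
  position∈S zero             = InS-decide 0ℚ
  position∈S (suc zero)       = InS-decide two
  position∈S (suc (suc zero)) = InS-decide four

  position-injective : ∀ i j → position i ≡ position j → i ≡ j
  position-injective zero             zero             _  = refl
  position-injective (suc zero)       (suc zero)       _  = refl
  position-injective (suc (suc zero)) (suc (suc zero)) _  = refl
  position-injective zero             (suc zero)       ()
  position-injective zero             (suc (suc zero)) ()
  position-injective (suc zero)       zero             ()
  position-injective (suc zero)       (suc (suc zero)) ()
  position-injective (suc (suc zero)) zero             ()
  position-injective (suc (suc zero)) (suc zero)       ()

  forward : ∀ x y {_ : True (0ℚ <? y - x)} {_ : True (y - x <? lowerπ 0)} → T true ⇔ Arc x y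
  forward x y {p} {q} = mk⇔ (λ _ → inj₁ (toWitness p , 0 , toWitness q)) (λ _ → tt)

  none : ∀ x y → (y - x ≤ 0ℚ) ⊎ (four ≤ y - x) → - (y - x) ≤ two → T false ⇔ Arc x y
  none x y gap short = mk⇔ (λ ()) (¬Arc x y gap short)

  arcs : ∀ i j → T (frel cycle₃ zero i j) ⇔ Arc (position i) (position j)
  arcs zero             (suc zero)       = forward 0ℚ two
  arcs (suc zero)       (suc (suc zero)) = forward two four
  arcs (suc (suc zero)) zero             = mk⇔ (λ _ → inj₂ (1 , <-decide (upperπ 1) (- (0ℚ - four)))) (λ _ → tt)
  arcs zero             zero             = mk⇔ (λ ()) (Arc-irrefl 0ℚ)
  arcs (suc zero)       (suc zero)       = mk⇔ (λ ()) (Arc-irrefl two)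
  arcs (suc (suc zero)) (suc (suc zero)) = mk⇔ (λ ()) (Arc-irrefl four)
  arcs zero             (suc (suc zero)) = none 0ℚ four (inj₂ (≤-decide four four)) (≤-decide (- four) two)
  arcs (suc zero)       zero             = none two 0ℚ (inj₁ (≤-decide (0ℚ - two) 0ℚ)) (≤-decide two two)
  arcs (suc (suc zero)) (suc zero)       = none four two (inj₁ (≤-decide (two - four) 0ℚ)) (≤-decide two two)

open LinearOrderExpansion using (ordered; ordered-emb; S2<-loopless)

S2<-¬VertexRamsey : ∀ _≺_ → IsLinearOrderOnS _≺_ → ¬ VertexRamsey (Age (S2< _≺_))
S2<-¬VertexRamsey _≺_ linear vertexRamsey
  with vertexRamsey 4 (ordered _≺_ linear cycle₃-emb) (ordered-emb _≺_ linear cycle₃-emb)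
... | m , C , C∈Age , arrows with arrows (band ∘ map C∈Age)
... | g , monochromatic = monochromatic-3-cycle-impossible (on-S 0F) (on-S 1F) (on-S 2F)
  (monochromatic 0F 1F) (monochromatic 1F 2F) (arc 0F 1F) (arc 1F 2F) (arc 2F 0F)
  where
  e : Emb (ordered _≺_ linear cycle₃-emb) (S2< _≺_)
  e = emb-∘ C∈Age g

  0F 1F 2F : Fin 3
  0F = zero
  1F = suc zero
  2F = suc (suc zero)

  on-S : ∀ i → InS (map e i)
  on-S = inDom e

  arc : ∀ i j {_ : T (frel cycle₃ zero i j)} → Arc (map e i) (map e j)
  arc i j {i→j} = Equivalence.to (pres e zero i j) i→j

proposition7p1 : (_≺_ : ℚ → ℚ → Set) → IsLinearOrderOnS _≺_ →
    ¬ (Ramsey (Age (S2< _≺_)) × Expansion (Age (S2< _≺_)) (Age S2))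
proposition7p1 _≺_ linear (ramsey , _) = S2<-¬VertexRamsey _≺_ linear
  (Ramsey⇒VertexRamsey ramsey (point-emb 0∈S (λ ρ → S2<-loopless _≺_ linear ρ 0∈S))
    (λ C∈Age → emb-loopless C∈Age (S2<-loopless _≺_ linear)))
  where
  0∈S : InS 0ℚ
  0∈S = ≤-refl , 0 , <-decide (0ℚ * ½) (lowerπ 0)
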